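{- Let $p$ be an odd prime, and let $R$ be the $(p-1)\times(p-1)$ integer matrix whose $(i,j)$ entry is $ij \operatorname{rem} p$ for $1 \le i, j \le p-1$. Then $\operatorname{rank}(R) \le (p+1)/2$.
   Context: $ij \operatorname{rem} p$ denotes the remainder in $\{0,\dots,p-1\}$ of $ij$ upon division by $p$. $\operatorname{rank}$ denotes rank over $\mathbb{Z}$ (equivalently over $\mathbb{Q}$). -}

module Defs where

open import Data.Nat using (ℕ; zero; suc; _+_; _*_; _∸_; _≤_; NonZero)
open import Data.Nat.DivMod using (_%_)
open import Data.Fin using (Fin; toℕ)
import Data.Fin as Fin
open import Data.Integer using (ℤ; +_) renaming (_+_ to _+ℤ_; _*_ to _*ℤ_)
open import Relation.Binary.PropositionalEquality using (_≡_)

Matrix : ℕ → ℕ → Set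
Matrix m n = Fin m → Fin n → ℤ

sumℤ : (k : ℕ) → (Fin k → ℤ) → ℤ
sumℤ zero    f = + 0
sumℤ (suc k) f = f Fin.zero +ℤ sumℤ k (λ j → f (Fin.suc j))

-- A family of k columns c of M is linearly independent over ℤ
-- (equivalently over ℚ, by clearing denominators).
LinIndepCols : {m n : ℕ} → Matrix m n → (k : ℕ) → (Fin k → Fin n) → Set
LinIndepCols {m} M k c =
  (a : Fin k → ℤ) →
  (∀ (i : Fin m) → sumℤ k (λ j → a j *ℤ M i (c j)) ≡ + 0) →
  ∀ (j : Fin k) → a j ≡ + 0

RankAtMost : {m n : ℕ} → Matrix m n → ℕ → Set
RankAtMost {m} {n} M r =
  ∀ (k : ℕ) (c : Fin k → Fin n) → LinIndepCols M k c → k ≤ r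

-- The (p-1)×(p-1) matrix R with R_{ij} = ij rem p, for 1 ≤ i,j ≤ p-1
-- (index i : Fin (p ∸ 1) represents the row number toℕ i + 1).
remMatrix : (p : ℕ) → .{{NonZero p}} → Matrix (p ∸ 1) (p ∸ 1)
remMatrix p i j = + (((suc (toℕ i)) * (suc (toℕ j))) % p)

-- Write p = 2m + 1. For 1 ≤ j ≤ p - 1 and the complementary column p - j, the entries
-- ij rem p and i(p - j) rem p are nonzero residues summing to 0 mod p, hence to p: every
-- column pair {j, p - j} sums to the constant column p. So the p - 1 columns fall into m
-- classes {j, p - j}, and among m + 2 columns pigeonhole yields either a repeated column
-- or two complementary pairs with c i + c j = c x + c y and i ∉ {x, y}; both are linear
-- dependencies.
module Submission where

open import Defs
open import Data.Fin using (Fin; zero; suc; toℕ; fromℕ<; opposite; punchIn; _≟_)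
open import Data.Fin.Properties
  using (toℕ<n; toℕ-fromℕ<; toℕ-injective; opposite-prop; opposite-involutive; <⇒≢; pigeonhole; punchInᵢ≢i; punchIn-injective)
open import Data.Integer using (ℤ; +_; -_; _-_) renaming (_+_ to _+ℤ_; _*_ to _*ℤ_)
import Data.Integer.Properties as ℤ
open import Algebra.Properties.CommutativeSemigroup ℤ.+-commutativeSemigroup using (interchange)
open import Data.Nat using (ℕ; zero; suc; _+_; _*_; _≤_; _<_; NonZero; s≤s; s<s; _≤?_)
open import Data.Nat.Properties
  using (+-suc; +-identityʳ; *-comm; *-distribˡ-+; m+n≡0⇒m≡0; m≤m+n; m+[n∸m]≡n; +-monoˡ-≤; +-monoʳ-≤; +-mono-<;
         +-cancelˡ-≤; >⇒≢; <⇒≱; ≰⇒>; n≢0⇒n>0; m<n⇒m<1+n; module ≤-Reasoning)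
open import Data.Nat.Tactic.RingSolver using (solve-∀)
open import Data.Nat.DivMod using (_/_; _%_; m≡m%n+[m/n]*n; %-distribˡ-+; m*n%n≡0; m%n<n; m*n/n≡m)
open import Data.Nat.Divisibility using (_∣_; divides; ∣⇒≤; m%n≡0⇒n∣m)
open import Data.Nat.Primality using (Prime; euclidsLemma)
open import Data.Product using (_,_)
open import Data.Sum using (_⊎_; inj₁; inj₂)
open import Function using (_∘_; Injective)
open import Relation.Nullary using (¬_; yes; no; contradiction)
open import Relation.Binary.PropositionalEquality

sumℤ-cong : ∀ k {f g : Fin k → ℤ} → (∀ j → f j ≡ g j) → sumℤ k f ≡ sumℤ k g
sumℤ-cong zero    f≗g = refl
sumℤ-cong (suc k) f≗g = cong₂ _+ℤ_ (f≗g zero) (sumℤ-cong k (f≗g ∘ suc))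

sumℤ-zero : ∀ k → sumℤ k (λ _ → + 0) ≡ + 0
sumℤ-zero zero    = refl
sumℤ-zero (suc k) = trans (ℤ.+-identityˡ _) (sumℤ-zero k)

sumℤ-+ : ∀ k (f g : Fin k → ℤ) → sumℤ k (λ j → f j +ℤ g j) ≡ sumℤ k f +ℤ sumℤ k g
sumℤ-+ zero    f g = refl
sumℤ-+ (suc k) f g = trans (cong (f zero +ℤ g zero +ℤ_) (sumℤ-+ k (f ∘ suc) (g ∘ suc)))
                           (interchange (f zero) (g zero) _ _)

sumℤ-neg : ∀ k (f : Fin k → ℤ) → sumℤ k (λ j → - f j) ≡ - sumℤ k f
sumℤ-neg zero    f = refl
sumℤ-neg (suc k) f = trans (cong (- f zero +ℤ_) (sumℤ-neg k (f ∘ suc))) (sym (ℤ.neg-distrib-+ (f zero) _))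

_·_ : ∀ {k} → (Fin k → ℤ) → (Fin k → ℤ) → ℤ
_·_ {k} a v = sumℤ k (λ j → a j *ℤ v j)

·-distribʳ-+ : ∀ {k} (a b v : Fin k → ℤ) → (λ j → a j +ℤ b j) · v ≡ a · v +ℤ b · v
·-distribʳ-+ {k} a b v = trans (sumℤ-cong k (λ j → ℤ.*-distribʳ-+ (v j) (a j) (b j)))
                               (sumℤ-+ k (λ j → a j *ℤ v j) (λ j → b j *ℤ v j))

·-distribʳ-- : ∀ {k} (a b v : Fin k → ℤ) → (λ j → a j - b j) · v ≡ a · v - b · v
·-distribʳ-- {k} a b v = begin
  (λ j → a j - b j) · v                  ≡⟨ ·-distribʳ-+ a (-_ ∘ b) v ⟩
  a · v +ℤ (-_ ∘ b) · v                  ≡⟨ cong (a · v +ℤ_) (sumℤ-cong k (λ j → sym (ℤ.neg-distribˡ-* (b j) (v j)))) ⟩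
  a · v +ℤ sumℤ k (λ j → - (b j *ℤ v j)) ≡⟨ cong (a · v +ℤ_) (sumℤ-neg k (λ j → b j *ℤ v j)) ⟩
  a · v - b · v                          ∎
  where open ≡-Reasoning

δ : ∀ {k} → Fin k → Fin k → ℤ
δ zero    zero    = + 1
δ zero    (suc _) = + 0
δ (suc _) zero    = + 0
δ (suc x) (suc y) = δ x y

δ-refl : ∀ {k} (x : Fin k) → δ x x ≡ + 1
δ-refl zero    = refl
δ-refl (suc x) = δ-refl x

δ-≢ : ∀ {k} {x y : Fin k} → x ≢ y → δ x y ≡ + 0
δ-≢ {x = zero}  {zero}  x≢y = contradiction refl x≢y
δ-≢ {x = zero}  {suc y} x≢y = refl
δ-≢ {x = suc x} {zero}  x≢y = refl
δ-≢ {x = suc x} {suc y} x≢y = δ-≢ (x≢y ∘ cong suc)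

δ·v≡v : ∀ {k} (x : Fin k) (v : Fin k → ℤ) → δ x · v ≡ v x
δ·v≡v {suc k} zero    v = trans (cong₂ _+ℤ_ (ℤ.*-identityˡ (v zero)) (sumℤ-zero k)) (ℤ.+-identityʳ (v zero))
δ·v≡v {suc k} (suc x) v = trans (ℤ.+-identityˡ _) (δ·v≡v x (v ∘ suc))

module _ {m n : ℕ} {M : Matrix m n} {k : ℕ} {c : Fin k → Fin n} (indep : LinIndepCols M k c) where

  linIndep⇒pairSums≢ : ∀ {i j x y} → i ≢ j → i ≢ x → i ≢ y →
                       ¬ (∀ r → M r (c i) +ℤ M r (c j) ≡ M r (c x) +ℤ M r (c y))
  linIndep⇒pairSums≢ {i} {j} {x} {y} i≢j i≢x i≢y sums = contradiction (trans (sym aᵢ≡1) (indep a a·col≡0 i)) λ ()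
    where
    a : Fin k → ℤ
    a z = (δ i z +ℤ δ j z) - (δ x z +ℤ δ y z)
    aᵢ≡1 : a i ≡ + 1
    aᵢ≡1 = cong₂ _-_ (cong₂ _+ℤ_ (δ-refl i) (δ-≢ (i≢j ∘ sym)))
                     (cong₂ _+ℤ_ (δ-≢ (i≢x ∘ sym)) (δ-≢ (i≢y ∘ sym)))
    a·col≡0 : ∀ r → a · (λ z → M r (c z)) ≡ + 0
    a·col≡0 r = begin
      a · v                                                      ≡⟨ ·-distribʳ-- (δ₂ i j) (δ₂ x y) v ⟩
      δ₂ i j · v - δ₂ x y · v                                    ≡⟨ cong₂ _-_ (δ₂·v i j) (δ₂·v x y) ⟩
      (v i +ℤ v j) - (v x +ℤ v y)                                ≡⟨ cong (_- (v x +ℤ v y)) (sums r) ⟩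
      (v x +ℤ v y) - (v x +ℤ v y)                                ≡⟨ ℤ.+-inverseʳ (v x +ℤ v y) ⟩
      + 0                                                        ∎
      where
      open ≡-Reasoning
      v : Fin k → ℤ
      v z = M r (c z)
      δ₂ : Fin k → Fin k → Fin k → ℤ
      δ₂ u w z = δ u z +ℤ δ w z
      δ₂·v : ∀ u w → δ₂ u w · v ≡ v u +ℤ v w
      δ₂·v u w = trans (·-distribʳ-+ (δ u) (δ w) v) (cong₂ _+ℤ_ (δ·v≡v u v) (δ·v≡v w v))

  linIndep⇒injective : Injective _≡_ _≡_ c
  linIndep⇒injective {x} {y} cx≡cy with x ≟ y
  ... | yes x≡y = x≡y
  ... | no  x≢y = contradiction (λ r → cong (λ t → M r t +ℤ M r (c y)) cx≡cy) (linIndep⇒pairSums≢ x≢y x≢y x≢y)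

residues-+≡modulus : ∀ {n x y} → x < n → y < n → 0 < x → n ∣ x + y → x + y ≡ n
residues-+≡modulus         x<n y<n 0<x (divides 0 x+y≡0) = contradiction (m+n≡0⇒m≡0 _ x+y≡0) (>⇒≢ 0<x)
residues-+≡modulus {n}     x<n y<n 0<x (divides 1 x+y≡n) = trans x+y≡n (+-identityʳ n)
residues-+≡modulus {n}     x<n y<n 0<x (divides (suc (suc q)) x+y≡q*n) =
  contradiction (subst (n + n ≤_) (sym x+y≡q*n) (+-monoʳ-≤ n (m≤m+n n (q * n)))) (<⇒≱ (+-mono-< x<n y<n))

prime⇒*%≢0 : ∀ {p a b} .{{_ : NonZero p}} → Prime p → suc a < p → suc b < p → (suc a * suc b) % p ≢ 0
prime⇒*%≢0 {p} p-prime a<p b<p ab%p≡0 with euclidsLemma _ _ p-prime (m%n≡0⇒n∣m _ p ab%p≡0)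
... | inj₁ p∣a = <⇒≱ a<p (∣⇒≤ p∣a)
... | inj₂ p∣b = <⇒≱ b<p (∣⇒≤ p∣b)

suc-toℕ-+-opposite : ∀ {n} (i : Fin n) → suc (toℕ i) + toℕ (opposite i) ≡ n
suc-toℕ-+-opposite i = trans (cong (λ t → suc (toℕ i) + t) (opposite-prop i)) (m+[n∸m]≡n (toℕ<n i))

-- Column opposite j is the paper's column p - (j + 1).
remMatrix-+-opposite : ∀ {n} → Prime (suc n) → ∀ i j →
                       remMatrix (suc n) i j +ℤ remMatrix (suc n) i (opposite j) ≡ + suc n
remMatrix-+-opposite {n} p-prime i j =
  cong +_ (residues-+≡modulus (m%n<n (a * b) p) (m%n<n (a * b′) p) (n≢0⇒n>0 (prime⇒*%≢0 p-prime (s<s (toℕ<n i)) (s<s (toℕ<n j))))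
                             (m%n≡0⇒n∣m _ p residues≡0))
  where
  open ≡-Reasoning
  p a b b′ : ℕ
  p = suc n
  a = suc (toℕ i)
  b = suc (toℕ j)
  b′ = suc (toℕ (opposite j))
  b+b′≡p : b + b′ ≡ p
  b+b′≡p = trans (+-suc b _) (cong suc (suc-toℕ-+-opposite j))
  residues≡0 : (a * b % p + a * b′ % p) % p ≡ 0
  residues≡0 = begin
    (a * b % p + a * b′ % p) % p ≡⟨ %-distribˡ-+ (a * b) (a * b′) p ⟨
    (a * b + a * b′) % p         ≡⟨ cong (_% p) (*-distribˡ-+ a b b′) ⟨
    a * (b + b′) % p             ≡⟨ cong (λ t → a * t % p) b+b′≡p ⟩
    a * p % p                    ≡⟨ m*n%n≡0 a p ⟩
    0                            ∎

opposite<half : ∀ {m} (t : Fin (m + m)) → m ≤ toℕ t → toℕ (opposite t) < m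
opposite<half {m} t m≤t = +-cancelˡ-≤ m (suc (toℕ (opposite t))) m (begin
  m + suc (toℕ (opposite t))      ≡⟨ +-suc m _ ⟩
  suc m + toℕ (opposite t)        ≤⟨ +-monoˡ-≤ _ (s≤s m≤t) ⟩
  suc (toℕ t) + toℕ (opposite t)  ≡⟨ suc-toℕ-+-opposite t ⟩
  m + m                           ∎)
  where open ≤-Reasoning

oppositeClass : ∀ m → Fin (m + m) → Fin m
oppositeClass m t with m ≤? toℕ t
... | yes m≤t = fromℕ< (opposite<half t m≤t)
... | no  m≰t = fromℕ< (≰⇒> m≰t)

toℕ-oppositeClass : ∀ m (t : Fin (m + m)) → toℕ (oppositeClass m t) ≡ toℕ t ⊎ toℕ (oppositeClass m t) ≡ toℕ (opposite t)
toℕ-oppositeClass m t with m ≤? toℕ t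
... | yes m≤t = inj₂ (toℕ-fromℕ< (opposite<half t m≤t))
... | no  m≰t = inj₁ (toℕ-fromℕ< (≰⇒> m≰t))

oppositeClass-fibre : ∀ m (t s : Fin (m + m)) → oppositeClass m t ≡ oppositeClass m s → s ≡ t ⊎ s ≡ opposite t
oppositeClass-fibre m t s ft≡fs = fibre (toℕ-oppositeClass m s) (toℕ-oppositeClass m t)
  where
  same : ∀ {u v} → toℕ (oppositeClass m s) ≡ toℕ u → toℕ (oppositeClass m t) ≡ toℕ v → u ≡ v
  same fs≡u ft≡v = toℕ-injective (trans (sym fs≡u) (trans (cong toℕ (sym ft≡fs)) ft≡v))
  fibre : toℕ (oppositeClass m s) ≡ toℕ s ⊎ toℕ (oppositeClass m s) ≡ toℕ (opposite s) →
          toℕ (oppositeClass m t) ≡ toℕ t ⊎ toℕ (oppositeClass m t) ≡ toℕ (opposite t) → s ≡ t ⊎ s ≡ opposite t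
  fibre (inj₁ fs≡s)  (inj₁ ft≡t)  = inj₁ (same fs≡s ft≡t)
  fibre (inj₁ fs≡s)  (inj₂ ft≡t′) = inj₂ (same fs≡s ft≡t′)
  fibre (inj₂ fs≡s′) (inj₁ ft≡t)  = inj₂ (trans (sym (opposite-involutive s)) (cong opposite (same fs≡s′ ft≡t)))
  fibre (inj₂ fs≡s′) (inj₂ ft≡t′) = inj₁ (begin
    s                       ≡⟨ opposite-involutive s ⟨
    opposite (opposite s)   ≡⟨ cong opposite (same fs≡s′ ft≡t′) ⟩
    opposite (opposite t)   ≡⟨ opposite-involutive t ⟩
    t                       ∎)
    where open ≡-Reasoning

record PairCollisions {k} {A : Set} (f : Fin k → A) : Set where
  field
    i j x y : Fin k
    i≢j : i ≢ j
    x≢y : x ≢ y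
    i≢x : i ≢ x
    i≢y : i ≢ y
    fi≡fj : f i ≡ f j
    fx≡fy : f x ≡ f y

pigeonhole₂ : ∀ {m k} → suc m < k → (f : Fin k → Fin m) → PairCollisions f
pigeonhole₂ {m} {suc k} (s<s m<k) f with pigeonhole (m<n⇒m<1+n m<k) f
... | i , j , i<j , fi≡fj with pigeonhole m<k (f ∘ punchIn i)
... | x , y , x<y , fx≡fy = record
  { i = i ; j = j ; x = punchIn i x ; y = punchIn i y
  ; i≢j = <⇒≢ i<j
  ; x≢y = <⇒≢ x<y ∘ punchIn-injective i x y
  ; i≢x = punchInᵢ≢i i x ∘ sym
  ; i≢y = punchInᵢ≢i i y ∘ sym
  ; fi≡fj = fi≡fj
  ; fx≡fy = fx≡fy
  }

remMatrix-rankAtMost : ∀ m → Prime (suc (m + m)) → RankAtMost (remMatrix (suc (m + m))) (suc m)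
remMatrix-rankAtMost m p-prime k c indep with k ≤? suc m
... | yes k≤1+m = k≤1+m
... | no  k≰1+m = contradiction pairSums (linIndep⇒pairSums≢ {M = R} indep i≢j i≢x i≢y)
  where
  open PairCollisions (pigeonhole₂ (≰⇒> k≰1+m) (oppositeClass m ∘ c))
  R : Matrix (m + m) (m + m)
  R = remMatrix (suc (m + m))
  complementary : ∀ {z w} → z ≢ w → oppositeClass m (c z) ≡ oppositeClass m (c w) → c w ≡ opposite (c z)
  complementary z≢w fz≡fw with oppositeClass-fibre m (c _) (c _) fz≡fw
  ... | inj₁ cw≡cz  = contradiction (linIndep⇒injective {M = R} indep cw≡cz) (z≢w ∘ sym)
  ... | inj₂ cw≡cz′ = cw≡cz′
  pairSum≡p : ∀ {z w} → z ≢ w → oppositeClass m (c z) ≡ oppositeClass m (c w) → ∀ r → R r (c z) +ℤ R r (c w) ≡ + suc (m + m)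
  pairSum≡p {z} z≢w fz≡fw r = trans (cong (λ t → R r (c z) +ℤ R r t) (complementary z≢w fz≡fw))
                                    (remMatrix-+-opposite p-prime r (c z))
  pairSums : ∀ r → R r (c i) +ℤ R r (c j) ≡ R r (c x) +ℤ R r (c y)
  pairSums r = trans (pairSum≡p i≢j fi≡fj r) (sym (pairSum≡p x≢y fx≡fy r))

odd⇒≡1+half+half : ∀ {p} → p % 2 ≡ 1 → p ≡ suc (p / 2 + p / 2)
odd⇒≡1+half+half {p} p%2≡1 = begin
  p                       ≡⟨ m≡m%n+[m/n]*n p 2 ⟩
  p % 2 + p / 2 * 2       ≡⟨ cong₂ _+_ p%2≡1 (*-comm (p / 2) 2) ⟩
  1 + 2 * (p / 2)         ≡⟨ cong (λ t → suc (p / 2 + t)) (+-identityʳ (p / 2)) ⟩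
  suc (p / 2 + p / 2)     ∎
  where open ≡-Reasoning

half-of-1+odd : ∀ m → (suc (m + m) + 1) / 2 ≡ suc m
half-of-1+odd m = trans (cong (_/ 2) (1+odd≡2* m)) (m*n/n≡m (suc m) 2)
  where
  1+odd≡2* : ∀ n → suc (n + n) + 1 ≡ suc n * 2
  1+odd≡2* = solve-∀

lemma5 : (p : ℕ) → .{{_ : NonZero p}} → Prime p → p % 2 ≡ 1 →
    RankAtMost (remMatrix p) ((p + 1) / 2)
lemma5 p p-prime p%2≡1 with p / 2 | odd⇒≡1+half+half {p} p%2≡1
... | m | refl = subst (RankAtMost (remMatrix (suc (m + m)))) (sym (half-of-1+odd m)) (remMatrix-rankAtMost m p-prime)
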